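{- If $q$ is a prime power and $n,m \in \mathbb{N}$, then $h_q(nm) \geq \max\{h_q(n), h_q(m)\}$.
   Context: For a prime power $q$ and $n \in \mathbb{N}$, let $\sigma:\mathbb{F}_q^n\to\mathbb{F}_q^n$ be the cyclic shift $\sigma(\sum_{i=1}^n x_i e_i)=\sum_{i=1}^n x_{i-1}e_i$ (indices mod $n$), where $e_1,\dots,e_n$ is the standard basis. A subspace $U\le \mathbb{F}_q^n$ is cyclically covering if $\bigcup_{r=0}^{n-1}\sigma^r(U)=\mathbb{F}_q^n$. $h_q(n)$ denotes the maximum possible codimension of a cyclically covering subspace of $\mathbb{F}_q^n$. -}

module Defs where

open import Level using (Level; _⊔_)
open import Data.Nat using (ℕ; zero; suc; _^_; _≤_; _<_)
import Data.Nat as ℕ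
open import Data.Nat.Primality using (Prime)
open import Data.Fin using (Fin; zero; suc; fromℕ; inject₁; toℕ)
open import Data.Product using (Σ; ∃; ∃-syntax; _×_; _,_)
open import Function using (_∘_)
open import Relation.Nullary using (¬_)
open import Relation.Binary.PropositionalEquality using (_≡_)
open import Algebra.Bundles using (CommutativeRing)

IsPrimePower : ℕ → Set
IsPrimePower q = ∃[ p ] ∃[ k ] (Prime p × q ≡ p ^ suc k)

record FiniteField (c ℓ : Level) (q : ℕ) : Set (Level.suc (c ⊔ ℓ)) where
  field
    commRing : CommutativeRing c ℓ
  open CommutativeRing commRing public
    using (Carrier; _≈_; _+_; _*_; 0#; 1#)
  field
    0≉1      : ¬ (0# ≈ 1#)
    inverse  : ∀ x → ¬ (x ≈ 0#) → ∃[ y ] (x * y ≈ 1#)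
    enum     : Fin q → Carrier
    enum-inj : ∀ i j → enum i ≈ enum j → i ≡ j
    enum-sur : ∀ x → ∃[ i ] (enum i ≈ x)

module _ {c ℓ : Level} {q : ℕ} (F : FiniteField c ℓ q) where
  open FiniteField F using (Carrier; _≈_; _+_; _*_; 0#)

  Vec : ℕ → Set c
  Vec n = Fin n → Carrier

  _≈ᵥ_ : ∀ {n} → Vec n → Vec n → Set ℓ
  x ≈ᵥ y = ∀ j → x j ≈ y j

  ∑ : ∀ {k} → (Fin k → Carrier) → Carrier
  ∑ {zero}  f = 0#
  ∑ {suc k} f = f zero + ∑ (f ∘ suc)

  -- cyclic shift: (σ x)_i = x_{i-1}, indices mod n (0-based here)
  σ : ∀ {n} → Vec n → Vec n
  σ {zero}  x ()
  σ {suc n} x zero    = x (fromℕ n)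
  σ {suc n} x (suc i) = x (inject₁ i)

  σ^ : ∀ {n} → ℕ → Vec n → Vec n
  σ^ zero    x = x
  σ^ (suc r) x = σ (σ^ r x)

  lincomb : ∀ {k n} → (Fin k → Vec n) → (Fin k → Carrier) → Vec n
  lincomb v a j = ∑ (λ i → a i * v i j)

  LinIndep : ∀ {k n} → (Fin k → Vec n) → Set (c ⊔ ℓ)
  LinIndep {k} {n} v = ∀ (a : Fin k → Carrier) →
    lincomb v a ≈ᵥ (λ _ → 0#) → ∀ i → a i ≈ 0#

  CyclicallyCovering : ∀ {k n} → (Fin k → Vec n) → Set (c ⊔ ℓ)
  CyclicallyCovering {k} {n} v = ∀ (x : Vec n) →
    ∃[ r ] (r < n × ∃[ a ] (σ^ r (lincomb v a) ≈ᵥ x))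

  -- F^n has a cyclically covering subspace of codimension ≥ c'
  -- (the subspace being the span of a basis v of k vectors, dim = k,
  --  codim = n - k).  Equivalently: h_q(n) ≥ c'.
  HasCoveringCodim≥ : ℕ → ℕ → Set (c ⊔ ℓ)
  HasCoveringCodim≥ n c' = ∃[ k ] Σ (Fin k → Vec n) λ v →
    LinIndep v × CyclicallyCovering v × k ℕ.+ c' ≤ n

-- Split F^((a+1)b) into a+1 blocks of length b and let φ : F^((a+1)b) → F^b
-- add up the blocks.  Shifting cyclically the long vector shifts cyclically
-- its block sum, so the preimage φ⁻¹(U) of a cyclically covering U ≤ F^b is
-- again cyclically covering, and, φ being onto, it has the same codimension
-- as U.

module Submission where

open import Defs
open import Level using (Level)
open import Data.Nat using (ℕ; zero; suc; _≥_; s≤s)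
open import Data.Fin using (Fin; zero; suc; combine; remainder; _↑ˡ_; _↑ʳ_)
open import Data.Product using (∃-syntax; _,_; _×_)
open import Function using (_∘_)
open import Relation.Binary.PropositionalEquality as ≡ using (_≡_; _≗_)
open import Algebra.Bundles using (CommutativeRing)

module Cyclic where
  open import Data.Nat using (_+_; _*_)
  open import Data.Nat.Properties using (suc-injective; +-suc)
  open import Data.Nat.Tactic.RingSolver using (solve-∀)
  open import Data.Fin using (toℕ; fromℕ; inject₁; splitAt; join)
  open import Data.Fin.Properties using (toℕ-injective; toℕ-inject₁; toℕ-fromℕ; toℕ-combine; remQuot-combine; join-splitAt)
  open import Data.Fin.Relation.Unary.Top using (view; ‵fromℕ; ‵inject₁; view-fromℕ; view-inject₁)
  open import Data.Product using (proj₂)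
  open import Data.Sum using ([_,_])
  open import Relation.Binary.PropositionalEquality using (refl; trans; cong; cong₂; subst; module ≡-Reasoning)

  prev : ∀ {n} → Fin n → Fin n
  prev {suc n} zero    = fromℕ n
  prev {suc n} (suc i) = inject₁ i

  next : ∀ {n} → Fin n → Fin n
  next {suc n} i with view i
  ... | ‵fromℕ     = zero
  ... | ‵inject₁ j = suc j

  prev-next : ∀ {n} (i : Fin n) → prev (next i) ≡ i
  prev-next {suc n} i with view i
  ... | ‵fromℕ     = refl
  ... | ‵inject₁ j = refl

  next-prev : ∀ {n} (i : Fin n) → next (prev i) ≡ i
  next-prev {suc n} zero    rewrite view-fromℕ n   = refl
  next-prev {suc n} (suc i) rewrite view-inject₁ i = refl

  prev^ : ∀ {n} → ℕ → Fin n → Fin n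
  prev^ zero    i = i
  prev^ (suc r) i = prev^ r (prev i)

  next^ : ∀ {n} → ℕ → Fin n → Fin n
  next^ zero    i = i
  next^ (suc r) i = next (next^ r i)

  prev^-next^ : ∀ {n} r (i : Fin n) → prev^ r (next^ r i) ≡ i
  prev^-next^ zero    i = refl
  prev^-next^ (suc r) i = trans (cong (prev^ r) (prev-next (next^ r i))) (prev^-next^ r i)

  next^-prev^ : ∀ {n} r (i : Fin n) → next^ r (prev^ r i) ≡ i
  next^-prev^ zero    i = refl
  next^-prev^ (suc r) i = trans (cong next (next^-prev^ r (prev i))) (next-prev i)

  toℕ-prev : ∀ {n t} (i : Fin n) → toℕ i ≡ suc t → toℕ (prev i) ≡ t
  toℕ-prev (suc i) eq = trans (toℕ-inject₁ i) (suc-injective eq)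

  prevBlock : ∀ {a b} → Fin a → Fin b → Fin a
  prevBlock i zero    = prev i
  prevBlock i (suc _) = i

  prev-combine : ∀ {a b} (i : Fin a) (j : Fin b) →
                 prev (combine i j) ≡ combine (prevBlock i j) (prev j)
  prev-combine {b = suc b} i (suc j) = toℕ-injective (begin
    toℕ (prev (combine i (suc j)))  ≡⟨ toℕ-prev _ (trans (toℕ-combine i (suc j)) (+-suc _ _)) ⟩
    suc b * toℕ i + toℕ j           ≡⟨ cong (suc b * toℕ i +_) (toℕ-inject₁ j) ⟨
    suc b * toℕ i + toℕ (inject₁ j) ≡⟨ toℕ-combine i (inject₁ j) ⟨
    toℕ (combine i (inject₁ j))     ∎)
    where open ≡-Reasoning
  prev-combine {b = suc b} (suc i) zero = toℕ-injective (begin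
    toℕ (prev (combine (suc i) zero))            ≡⟨ toℕ-prev _ (trans (toℕ-combine (suc i) zero) (arith b (toℕ i))) ⟩
    suc b * toℕ i + b                            ≡⟨ cong₂ (λ x y → suc b * x + y) (toℕ-inject₁ i) (toℕ-fromℕ b) ⟨
    suc b * toℕ (inject₁ i) + toℕ (fromℕ b)      ≡⟨ toℕ-combine (inject₁ i) (fromℕ b) ⟨
    toℕ (combine (inject₁ i) (fromℕ b))          ∎)
    where
    open ≡-Reasoning
    arith : ∀ b i → suc b * suc i + 0 ≡ suc (suc b * i + b)
    arith = solve-∀
  prev-combine {suc a} {suc b} zero zero = toℕ-injective (begin
    toℕ (fromℕ (b + a * suc b))              ≡⟨ toℕ-fromℕ _ ⟩
    b + a * suc b                            ≡⟨ arith a b ⟩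
    suc b * a + b                            ≡⟨ cong₂ (λ x y → suc b * x + y) (toℕ-fromℕ a) (toℕ-fromℕ b) ⟨
    suc b * toℕ (fromℕ a) + toℕ (fromℕ b)    ≡⟨ toℕ-combine (fromℕ a) (fromℕ b) ⟨
    toℕ (combine (fromℕ a) (fromℕ b))        ∎)
    where
    open ≡-Reasoning
    arith : ∀ a b → b + a * suc b ≡ suc b * a + b
    arith = solve-∀

  remainder-combine : ∀ {a b} (i : Fin a) (j : Fin b) → remainder {a} b (combine i j) ≡ j
  remainder-combine i j = cong proj₂ (remQuot-combine i j)

  ↑-elim : ∀ {m n p} {P : Fin (m + n) → Set p} →
           (∀ i → P (i ↑ˡ n)) → (∀ j → P (m ↑ʳ j)) → ∀ k → P k
  ↑-elim {m} {n} {P = P} left right k =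
    subst P (join-splitAt m n k) ([_,_] {C = P ∘ join m n} left right (splitAt m k))

open Cyclic

module Covering {c ℓ q} (F : FiniteField c ℓ q) where
  open import Data.Nat as ℕ using (_≤_)
  open import Data.Nat.Properties using (≤-trans; ≤-reflexive; m≤m+n; +-monoˡ-≤; +-commutativeSemigroup)
  open import Algebra.Properties.CommutativeSemigroup +-commutativeSemigroup using (xy∙z≈xz∙y)
  open import Data.Vec.Functional using (_++_; take; drop)
  open import Data.Vec.Functional.Properties using (lookup-++ˡ; lookup-++ʳ)
  open FiniteField F using (commRing)
  open CommutativeRing commRing hiding (zero)
  open import Algebra.Properties.Ring ring using (-‿distribʳ-*; -‿+-comm; -0#≈0#; +-cancelʳ)
  open import Algebra.Properties.Semiring.Sum semiring
    using (sum; sum-cong-≋; sum-cong-≗; sum-init-last; sum-replicate-zero)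
  open import Data.Vec.Functional.Relation.Binary.Equality.Setoid setoid
    using (_≋_; ≋-refl; ≋-sym; ≋-trans)
  open import Relation.Binary.Reasoning.Setoid setoid

  ∑≡sum : ∀ {k} (f : Fin k → Carrier) → ∑ F f ≡ sum f
  ∑≡sum {zero}  f = ≡.refl
  ∑≡sum {suc k} f = ≡.cong (f zero +_) (∑≡sum (f ∘ suc))

  lincomb≡sum : ∀ {k n} (v : Fin k → Vec F n) α j → lincomb F v α j ≡ sum (λ t → α t * v t j)
  lincomb≡sum {k} v α j = ∑≡sum {k} _

  sum-zero : ∀ {k} {f : Fin k → Carrier} → (∀ i → f i ≈ 0#) → sum f ≈ 0#
  sum-zero {k} f≈0 = trans (sum-cong-≋ f≈0) (sum-replicate-zero k)

  sum-neg : ∀ {k} (f : Fin k → Carrier) → sum (λ i → - f i) ≈ - sum f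
  sum-neg {zero}  f = sym -0#≈0#
  sum-neg {suc k} f = trans (+-congˡ (sum-neg (f ∘ suc))) (-‿+-comm _ _)

  sum-++ : ∀ m {n} (f : Fin (m ℕ.+ n) → Carrier) → sum f ≈ sum (take m f) + sum (drop m f)
  sum-++ zero    f = sym (+-identityˡ _)
  sum-++ (suc m) f = trans (+-congˡ (sum-++ m (f ∘ suc))) (sym (+-assoc _ _ _))

  sum-combine : ∀ a {b} (f : Fin (a ℕ.* b) → Carrier) →
                sum f ≈ sum (λ (i : Fin a) → sum (λ (j : Fin b) → f (combine i j)))
  sum-combine zero        f = refl
  sum-combine (suc a) {b} f = trans (sum-++ b {a ℕ.* b} f) (+-congˡ (sum-combine a {b} (drop b f)))

  sum-prev : ∀ {n} (f : Fin n → Carrier) → sum (f ∘ prev) ≈ sum f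
  sum-prev {zero}  f = refl
  sum-prev {suc n} f = trans (+-comm _ _) (sym (sum-init-last f))

  e : ∀ {n} → Fin n → Vec F n
  e zero    zero    = 1#
  e zero    (suc j) = 0#
  e (suc i) zero    = 0#
  e (suc i) (suc j) = e i j

  lincomb-e : ∀ {n} (α : Fin n → Carrier) → lincomb F e α ≋ α
  lincomb-e α j = trans (reflexive (lincomb≡sum e α j)) (sum-*e α j)
    where
    sum-*e : ∀ {n} (α : Fin n → Carrier) j → sum (λ i → α i * e i j) ≈ α j
    sum-*e α zero    = trans (+-cong (*-identityʳ _) (sum-zero {f = λ i → α (suc i) * 0#} (λ i → zeroʳ _))) (+-identityʳ _)
    sum-*e α (suc j) = trans (+-cong (zeroʳ _) (sum-*e (α ∘ suc) j)) (+-identityˡ _)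

  lincomb-congʳ : ∀ {k n} (v : Fin k → Vec F n) {α β} → α ≋ β → lincomb F v α ≋ lincomb F v β
  lincomb-congʳ v {α} {β} α≋β j = begin
    lincomb F v α j              ≡⟨ lincomb≡sum v α j ⟩
    sum (λ t → α t * v t j)      ≈⟨ sum-cong-≋ (λ t → *-congʳ (α≋β t)) ⟩
    sum (λ t → β t * v t j)      ≡⟨ lincomb≡sum v β j ⟨
    lincomb F v β j              ∎

  lincomb-++ : ∀ {k k′ n} (u : Fin k → Vec F n) (u′ : Fin k′ → Vec F n) γ j →
               lincomb F (u ++ u′) γ j ≈ lincomb F u (take k γ) j + lincomb F u′ (drop k γ) j
  lincomb-++ {k} {k′} u u′ γ j = begin
    lincomb F (u ++ u′) γ j
      ≡⟨ lincomb≡sum (u ++ u′) γ j ⟩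
    sum (λ t → γ t * (u ++ u′) t j)
      ≈⟨ sum-++ k _ ⟩
    sum (λ t → γ (t ↑ˡ k′) * (u ++ u′) (t ↑ˡ k′) j) + sum (λ t → γ (k ↑ʳ t) * (u ++ u′) (k ↑ʳ t) j)
      ≡⟨ ≡.cong₂ _+_ (sum-cong-≗ (λ t → ≡.cong (λ x → γ (t ↑ˡ k′) * x j) (lookup-++ˡ u u′ t)))
                   (sum-cong-≗ (λ t → ≡.cong (λ x → γ (k ↑ʳ t) * x j) (lookup-++ʳ u u′ t))) ⟩
    sum (λ t → take k γ t * u t j) + sum (λ t → drop k γ t * u′ t j)
      ≡⟨ ≡.cong₂ _+_ (lincomb≡sum u (take k γ) j) (lincomb≡sum u′ (drop k γ) j) ⟨
    lincomb F u (take k γ) j + lincomb F u′ (drop k γ) j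
      ∎

  σ-prev : ∀ {n} (x : Vec F n) i → σ F x i ≡ x (prev i)
  σ-prev {suc n} x zero    = ≡.refl
  σ-prev {suc n} x (suc i) = ≡.refl

  σ^-prev^ : ∀ {n} r (x : Vec F n) i → σ^ F r x i ≡ x (prev^ r i)
  σ^-prev^ zero    x i = ≡.refl
  σ^-prev^ (suc r) x i = ≡.trans (σ-prev (σ^ F r x) i) (σ^-prev^ r x (prev i))

  σ^-cong : ∀ {n} r {x y : Vec F n} → x ≋ y → σ^ F r x ≋ σ^ F r y
  σ^-cong r {x} {y} x≋y i rewrite σ^-prev^ r x i | σ^-prev^ r y i = x≋y (prev^ r i)

  σ^-next^ : ∀ {n} r (x : Vec F n) → σ^ F r (x ∘ next^ r) ≗ x
  σ^-next^ r x i = ≡.trans (σ^-prev^ r (x ∘ next^ r) i) (≡.cong x (next^-prev^ r i))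

  σ^-injective : ∀ {n} r {x y : Vec F n} → σ^ F r x ≋ σ^ F r y → x ≋ y
  σ^-injective r {x} {y} σʳx≋σʳy i = begin
    x i                        ≡⟨ ≡.cong x (prev^-next^ r i) ⟨
    x (prev^ r (next^ r i))    ≡⟨ σ^-prev^ r x (next^ r i) ⟨
    σ^ F r x (next^ r i)       ≈⟨ σʳx≋σʳy (next^ r i) ⟩
    σ^ F r y (next^ r i)       ≡⟨ σ^-prev^ r y (next^ r i) ⟩
    y (prev^ r (next^ r i))    ≡⟨ ≡.cong y (prev^-next^ r i) ⟩
    y i                        ∎

  module _ {n b} (φ : Vec F n → Vec F b)
           (φ-cong : ∀ {y z} → y ≋ z → φ y ≋ φ z)
           (φ-σ : ∀ z → φ (σ F z) ≋ σ F (φ z)) where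

    φ-σ^ : ∀ r z → φ (σ^ F r z) ≋ σ^ F r (φ z)
    φ-σ^ zero    z = ≋-refl
    φ-σ^ (suc r) z = ≋-trans (φ-σ (σ^ F r z)) (σ^-cong 1 (φ-σ^ r z))

    CyclicallyCovering-preimage :
      ∀ {k k′} {v : Fin k → Vec F b} {w : Fin k′ → Vec F n} → b ≤ n →
      (∀ y α → φ y ≋ lincomb F v α → ∃[ γ ] lincomb F w γ ≋ y) →
      CyclicallyCovering F v → CyclicallyCovering F w
    CyclicallyCovering-preimage {v = v} {w} b≤n spans cov x =
      let r , r<b , α , σʳvα≋φx = cov (φ x)
          y = x ∘ next^ r
          σʳy≋x : σ^ F r y ≋ x
          σʳy≋x i = reflexive (σ^-next^ r x i)
          φy≋vα : φ y ≋ lincomb F v α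
          φy≋vα = σ^-injective r (≋-trans (≋-sym (φ-σ^ r y)) (≋-trans (φ-cong σʳy≋x) (≋-sym σʳvα≋φx)))
          γ , wγ≋y = spans y α φy≋vα
      in r , ≤-trans r<b b≤n , γ , ≋-trans (σ^-cong r wγ≋y) σʳy≋x

  fold : ∀ a {b} → Vec F (a ℕ.* b) → Vec F b
  fold a z j = sum (λ (i : Fin a) → z (combine i j))

  fold-cong : ∀ a {b} {y z : Vec F (a ℕ.* b)} → y ≋ z → fold a y ≋ fold a z
  fold-cong a y≋z j = sum-cong-≋ (λ (i : Fin a) → y≋z (combine i j))

  fold-zero : ∀ a {b} {z : Vec F (a ℕ.* b)} → (∀ i → z i ≈ 0#) → ∀ j → fold a z j ≈ 0#
  fold-zero a z≈0 j = sum-zero (λ (i : Fin a) → z≈0 (combine i j))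

  fold-σ : ∀ a {b} (z : Vec F (a ℕ.* b)) → fold a (σ F z) ≋ σ F (fold a z)
  fold-σ a {suc b} z j = begin
    fold a (σ F z) j
      ≡⟨ sum-cong-≗ (λ (i : Fin a) → ≡.trans (σ-prev z (combine i j)) (≡.cong z (prev-combine i j))) ⟩
    sum (λ (i : Fin a) → z (combine (prevBlock i j) (prev j)))
      ≈⟨ blocks j ⟩
    fold a z (prev j)
      ≡⟨ σ-prev (fold a z) j ⟨
    σ F (fold a z) j
      ∎
    where
    blocks : ∀ j → sum (λ (i : Fin a) → z (combine (prevBlock i j) (prev j))) ≈ fold a z (prev j)
    blocks zero    = sum-prev (λ (i : Fin a) → z (combine i (prev {suc b} zero)))
    blocks (suc j) = refl

  fold-suc-injective : ∀ a {b} {y z : Vec F (suc a ℕ.* b)} →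
                       fold (suc a) y ≋ fold (suc a) z → drop b y ≋ drop b z → y ≋ z
  fold-suc-injective a {b} {y} {z} fy≋fz dy≋dz = ↑-elim first dy≋dz
    where
    first : ∀ j → y (j ↑ˡ a ℕ.* b) ≈ z (j ↑ˡ a ℕ.* b)
    first j = +-cancelʳ (fold a (drop b y) j) _ _
                (trans (fy≋fz j) (+-congˡ (fold-cong a (≋-sym dy≋dz) j)))

  module FoldPreimage (a b : ℕ) {k} (v : Fin k → Vec F b) where

    embed : Vec F b → Vec F (suc a ℕ.* b)
    embed u = u ++ (λ _ → 0#)

    -- The vector e_(b+l) − e_(l mod b), which fold sends to 0; together with
    -- the embedded v these form a basis of the preimage of span v under fold.
    kernelBasis : Fin (a ℕ.* b) → Vec F (suc a ℕ.* b)
    kernelBasis l = (λ j → - e (remainder {a} b l) j) ++ e l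

    preimageBasis : Fin (k ℕ.+ a ℕ.* b) → Vec F (suc a ℕ.* b)
    preimageBasis = (embed ∘ v) ++ kernelBasis

    lincomb-embed-↑ˡ : ∀ α j → lincomb F (embed ∘ v) α (j ↑ˡ a ℕ.* b) ≡ lincomb F v α j
    lincomb-embed-↑ˡ α j = ≡.trans (lincomb≡sum (embed ∘ v) α _) (≡.trans
      (sum-cong-≗ (λ t → ≡.cong (α t *_) (lookup-++ˡ (v t) (λ _ → 0#) j)))
      (≡.sym (lincomb≡sum v α j)))

    lincomb-embed-↑ʳ : ∀ α l → lincomb F (embed ∘ v) α (b ↑ʳ l) ≈ 0#
    lincomb-embed-↑ʳ α l = trans (reflexive (lincomb≡sum (embed ∘ v) α _))
      (sum-zero (λ t → trans (*-congˡ (reflexive (lookup-++ʳ (v t) (λ _ → 0#) l))) (zeroʳ _)))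

    lincomb-kernelBasis-↑ʳ : ∀ β l → lincomb F kernelBasis β (b ↑ʳ l) ≈ β l
    lincomb-kernelBasis-↑ʳ β l = begin
      lincomb F kernelBasis β (b ↑ʳ l)
        ≡⟨ lincomb≡sum kernelBasis β _ ⟩
      sum (λ l′ → β l′ * kernelBasis l′ (b ↑ʳ l))
        ≡⟨ sum-cong-≗ (λ l′ → ≡.cong (β l′ *_) (lookup-++ʳ (λ j → - e (remainder {a} b l′) j) (e l′) l)) ⟩
      sum (λ l′ → β l′ * e l′ l)
        ≡⟨ lincomb≡sum e β l ⟨
      lincomb F e β l
        ≈⟨ lincomb-e β l ⟩
      β l
        ∎

    lincomb-kernelBasis-↑ˡ : ∀ β j → lincomb F kernelBasis β (j ↑ˡ a ℕ.* b) ≈ - fold a β j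
    lincomb-kernelBasis-↑ˡ β j = begin
      lincomb F kernelBasis β (j ↑ˡ a ℕ.* b)
        ≡⟨ lincomb≡sum kernelBasis β _ ⟩
      sum (λ l → β l * kernelBasis l (j ↑ˡ a ℕ.* b))
        ≡⟨ sum-cong-≗ (λ l → ≡.cong (β l *_) (lookup-++ˡ _ (e l) j)) ⟩
      sum (λ l → β l * - e (remainder {a} b l) j)
        ≈⟨ sum-cong-≋ (λ l → sym (-‿distribʳ-* (β l) (e (remainder {a} b l) j))) ⟩
      sum (λ l → - (β l * e (remainder {a} b l) j))
        ≈⟨ sum-neg (λ l → β l * e (remainder {a} b l) j) ⟩
      - sum (λ l → β l * e (remainder {a} b l) j)
        ≈⟨ -‿cong (sum-combine a (λ l → β l * e (remainder {a} b l) j)) ⟩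
      - sum (λ (i : Fin a) → sum (λ j′ → β (combine i j′) * e (remainder {a} b (combine i j′)) j))
        ≡⟨ ≡.cong -_ (sum-cong-≗ (λ (i : Fin a) → sum-cong-≗ (λ j′ → ≡.cong (λ r → β (combine i j′) * e r j) (remainder-combine i j′)))) ⟩
      - sum (λ (i : Fin a) → sum (λ j′ → β (combine i j′) * e j′ j))
        ≈⟨ -‿cong (sum-cong-≋ (λ (i : Fin a) → trans (reflexive (≡.sym (lincomb≡sum e (β ∘ combine i) j))) (lincomb-e (β ∘ combine i) j))) ⟩
      - fold a β j
        ∎

    lincomb-preimageBasis-↑ʳ : ∀ γ l → lincomb F preimageBasis γ (b ↑ʳ l) ≈ drop k γ l
    lincomb-preimageBasis-↑ʳ γ l = trans (lincomb-++ (embed ∘ v) kernelBasis γ _)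
      (trans (+-cong (lincomb-embed-↑ʳ _ l) (lincomb-kernelBasis-↑ʳ _ l)) (+-identityˡ _))

    fold-lincomb-preimageBasis : ∀ γ → fold (suc a) (lincomb F preimageBasis γ) ≋ lincomb F v (take k γ)
    fold-lincomb-preimageBasis γ j = begin
      w (j ↑ˡ a ℕ.* b) + fold a (drop b w) j
        ≈⟨ +-congˡ (fold-cong a (lincomb-preimageBasis-↑ʳ γ) j) ⟩
      w (j ↑ˡ a ℕ.* b) + f
        ≈⟨ +-congʳ (lincomb-++ (embed ∘ v) kernelBasis γ _) ⟩
      lincomb F (embed ∘ v) (take k γ) (j ↑ˡ a ℕ.* b) + lincomb F kernelBasis (drop k γ) (j ↑ˡ a ℕ.* b) + f
        ≈⟨ +-congʳ (+-cong (reflexive (lincomb-embed-↑ˡ _ j)) (lincomb-kernelBasis-↑ˡ _ j)) ⟩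
      lincomb F v (take k γ) j + - f + f
        ≈⟨ +-assoc _ _ _ ⟩
      lincomb F v (take k γ) j + (- f + f)
        ≈⟨ +-congˡ (-‿inverseˡ f) ⟩
      lincomb F v (take k γ) j + 0#
        ≈⟨ +-identityʳ _ ⟩
      lincomb F v (take k γ) j
        ∎
      where
      w = lincomb F preimageBasis γ
      f = fold a (drop k γ) j

    preimageBasis-linIndep : LinIndep F v → LinIndep F preimageBasis
    preimageBasis-linIndep indep γ wγ≋0 = ↑-elim {P = λ t → γ t ≈ 0#} takeγ≈0 dropγ≈0
      where
      dropγ≈0 : ∀ l → drop k γ l ≈ 0#
      dropγ≈0 l = trans (sym (lincomb-preimageBasis-↑ʳ γ l)) (wγ≋0 (b ↑ʳ l))
      takeγ≈0 : ∀ t → take k γ t ≈ 0#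
      takeγ≈0 = indep (take k γ) (λ j → begin
        lincomb F v (take k γ) j                     ≈⟨ fold-lincomb-preimageBasis γ j ⟨
        fold (suc a) (lincomb F preimageBasis γ) j   ≈⟨ fold-zero (suc a) wγ≋0 j ⟩
        0#                                           ∎)

    preimageBasis-spans : ∀ y α → fold (suc a) y ≋ lincomb F v α →
                          ∃[ γ ] lincomb F preimageBasis γ ≋ y
    preimageBasis-spans y α fy≋vα = γ , fold-suc-injective a folds drops
      where
      γ = α ++ drop b y
      folds : fold (suc a) (lincomb F preimageBasis γ) ≋ fold (suc a) y
      folds j = begin
        fold (suc a) (lincomb F preimageBasis γ) j   ≈⟨ fold-lincomb-preimageBasis γ j ⟩
        lincomb F v (take k γ) j                     ≈⟨ lincomb-congʳ v (λ t → reflexive (lookup-++ˡ α _ t)) j ⟩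
        lincomb F v α j                              ≈⟨ fy≋vα j ⟨
        fold (suc a) y j                             ∎
      drops : drop b (lincomb F preimageBasis γ) ≋ drop b y
      drops l = trans (lincomb-preimageBasis-↑ʳ γ l) (reflexive (lookup-++ʳ α _ l))

  HasCoveringCodim≥-* : ∀ a b d → HasCoveringCodim≥ F b d → HasCoveringCodim≥ F (suc a ℕ.* b) d
  HasCoveringCodim≥-* a b d (k , v , indep , cov , k+d≤b) =
    k ℕ.+ a ℕ.* b , preimageBasis , preimageBasis-linIndep indep ,
    CyclicallyCovering-preimage (fold (suc a)) (fold-cong (suc a)) (fold-σ (suc a))
      (m≤m+n b (a ℕ.* b)) preimageBasis-spans cov ,
    ≤-trans (≤-reflexive (xy∙z≈xz∙y k (a ℕ.* b) d)) (+-monoˡ-≤ (a ℕ.* b) k+d≤b)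
    where open FoldPreimage a b v

open Covering using (HasCoveringCodim≥-*)
open import Data.Nat using (_*_)
open import Data.Nat.Properties using (*-comm)

lemma2p2 : ∀ {c ℓ : Level} (q : ℕ) → IsPrimePower q → (F : FiniteField c ℓ q) →
    ∀ (n m : ℕ) → n ≥ 1 → m ≥ 1 →
      (∀ (d : ℕ) → HasCoveringCodim≥ F n d → HasCoveringCodim≥ F (n * m) d) ×
      (∀ (d : ℕ) → HasCoveringCodim≥ F m d → HasCoveringCodim≥ F (n * m) d)
lemma2p2 q _ F (suc n) (suc m) (s≤s _) (s≤s _) =
  (λ d → ≡.subst (λ N → HasCoveringCodim≥ F N d) (*-comm (suc m) (suc n))
         ∘ HasCoveringCodim≥-* F m (suc n) d) ,
  HasCoveringCodim≥-* F n (suc m)
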